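{- Let $b\geq 2$ be an integer, $\mathcal{A}=\{0,\dots,b-1\}$, $k$ a positive integer and $r$ a positive integer coprime with $b$. Identify each word in $\mathcal{A}^k$ with an integer modulo $b^k$ via its base-$b$ representation (with $k$ digits). Let $s$ be the word of length $kb^k$ obtained by concatenating the words of $\mathcal{A}^k$ corresponding to $0, r, 2r, \dots, (b^k-1)r$ (taken modulo $b^k$), in this order. Then the necklace $[s]$ is $(k,k)$-perfect.
   Context: A necklace is the equivalence class of a word under cyclic rotations. A word $u$ of length $k$ occurs in a necklace $[s]$ (with $|s|=N$) at position $i$ if $s((i+t)\bmod N)=u(t)$ for $t=0,\dots,k-1$. A necklace is $(k,n)$-perfect if it has length $n|\mathcal{A}|^k$ and each word of length $k$ occurs in it exactly $n$ times, at positions that are pairwise different modulo $n$. A necklace is called perfect if it is $(k,k)$-perfect for some $k$. -}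

module Defs where

open import Data.Nat using (ℕ; zero; suc; _+_; _*_; _∸_; _^_; _<_; NonZero)
open import Data.Nat.DivMod using (_/_; _%_)
import Data.Nat.Properties
open import Data.Nat.DivMod using (m%n<n)
import Data.Fin
open import Data.Fin using (Fin; toℕ; fromℕ<)
open import Data.Product using (Σ; _×_; _,_)
open import Relation.Binary.PropositionalEquality using (_≡_)

Word : ℕ → ℕ → Set
Word b N = Fin N → Fin b

OccursAt : ∀ {b k N} → .{{_ : NonZero N}} → Word b k → Word b N → ℕ → Set
OccursAt {k = k} {N = N} u s i =
  (t : Fin k) → (p : ((i + toℕ t) % N) < N) → s (Data.Fin.fromℕ< p) ≡ u t

-- The necklace [s] is (k,n)-perfect: |s| = n b^k and every word u of length k
-- occurs exactly n times, at positions pairwise different modulo n.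
-- "Exactly n occurrences, pairwise different mod n" is rendered as: there is an
-- enumeration pos : Fin n → ℕ of positions < N which are occurrences of u, whose
-- residues mod n are pairwise distinct (hence the positions are distinct), and
-- every occurrence position of u is one of them.
IsKNPerfect : ∀ {b N} → .{{_ : NonZero N}} → (k n : ℕ) → .{{_ : NonZero n}} → Word b N → Set
IsKNPerfect {b} {N} k n s =
  (N ≡ n * b ^ k) ×
  ((u : Word b k) →
    Σ (Fin n → ℕ) λ pos →
      ((a : Fin n) → (pos a < N) × OccursAt u s (pos a)) ×
      ((a c : Fin n) → pos a % n ≡ pos c % n → a ≡ c) ×
      ((i : ℕ) → i < N → OccursAt u s i → Σ (Fin n) λ a → pos a ≡ i))

-- The word s of length k b^k: block j (0 ≤ j < b^k) holds the k base-b digits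
-- (most significant first) of (j r mod b^k).  Position p = j*k + t with t < k,
-- i.e. j = p / k, t = p % k, and the digit is ((j r mod b^k) / b^(k-1-t)) mod b.
multWord : (b k r : ℕ) → .{{_ : NonZero b}} → .{{_ : NonZero k}} → Word b (k * b ^ k)
multWord b k r p = fromℕ< (m%n<n (((toℕ p / k) * r % (b ^ k)) / (b ^ (k ∸ suc (toℕ p % k)))) b)
  where instance
    _ : NonZero (b ^ k)
    _ = Data.Nat.Properties.m^n≢0 b k
    _ : NonZero (b ^ (k ∸ suc (toℕ p % k)))
    _ = Data.Nat.Properties.m^n≢0 b (k ∸ suc (toℕ p % k))

lenNonZero : (b k : ℕ) → {{_ : NonZero b}} → {{_ : NonZero k}} → NonZero (k * b ^ k)
lenNonZero b k {{nb}} {{nk}} = Data.Nat.Properties.m*n≢0 k (b ^ k) {{nk}} {{Data.Nat.Properties.m^n≢0 b k {{nb}}}}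

module Submission where

-- Write B = b^k and N = k·B.  Block j of the word s (positions j·k, …, j·k+k-1)
-- spells the k base-b digits of  block j = j·r mod B,  and since block (j+B) =
-- block j, s extended periodically is the infinite word read cyclically.
-- An occurrence starting at position t + j·k (0 ≤ t < k, m = k - t) reads the
-- last m digits of block j followed by the first t digits of block (j+1).  For a
-- word u with value U these must be  U div b^t  and  U mod b^t  respectively.
-- Because block (j+1) ≡ block j + r (mod b^m), the two conditions together say
-- exactly that block (j+1) equals an explicit numeral target(U) < B.  As r is
-- invertible modulo B, for each offset t exactly one j < B satisfies this, so u
-- occurs exactly once at a position ≡ t (mod k), for every t < k.

open import Defs
open import Data.Nat using (ℕ; suc; _≤_; NonZero)
open import Data.Nat.Coprimality using (Coprime)
open import Data.Nat
open import Data.Nat.Properties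
open import Data.Nat.DivMod
open import Data.Nat.Divisibility using (_∣_; divides; m∣m*n; ∣-trans; ∣1⇒≡1)
open import Data.Nat.Coprimality using (coprime-divisor; coprime-Bézout)
open import Data.Nat.GCD using (module Bézout)
open import Data.Fin using (Fin; toℕ; fromℕ<; zero; suc)
open import Data.Fin.Properties using (toℕ-fromℕ<; toℕ-injective; toℕ<n)
open import Data.Product using (Σ; _×_; _,_; proj₁; proj₂)
open import Function.Bundles using (_⇔_; mk⇔; Equivalence)
open import Function.Construct.Composition using (_⇔-∘_)
open import Relation.Binary.PropositionalEquality
open import Relation.Nullary using (yes; no)
open import Data.Nat.Tactic.RingSolver using (solve-∀)

open Equivalence using (to; from)

%-absorbˡ-+ : ∀ x y M .{{_ : NonZero M}} → (x % M + y) % M ≡ (x + y) % M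
%-absorbˡ-+ x y M = begin
  (x % M + y) % M          ≡⟨ %-distribˡ-+ (x % M) y M ⟩
  (x % M % M + y % M) % M  ≡⟨ cong (λ z → (z + y % M) % M) (m%n%n≡m%n x M) ⟩
  (x % M + y % M) % M      ≡⟨ %-distribˡ-+ x y M ⟨
  (x + y) % M              ∎
  where open ≡-Reasoning

%-absorbʳ-+ : ∀ x y M .{{_ : NonZero M}} → (x + y % M) % M ≡ (x + y) % M
%-absorbʳ-+ x y M = begin
  (x + y % M) % M  ≡⟨ cong (_% M) (+-comm x (y % M)) ⟩
  (y % M + x) % M  ≡⟨ %-absorbˡ-+ y x M ⟩
  (y + x) % M      ≡⟨ cong (_% M) (+-comm y x) ⟩
  (x + y) % M      ∎
  where open ≡-Reasoning

%-absorbˡ-* : ∀ x y M .{{_ : NonZero M}} → (x % M * y) % M ≡ (x * y) % M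
%-absorbˡ-* x y M = begin
  (x % M * y) % M            ≡⟨ %-distribˡ-* (x % M) y M ⟩
  (x % M % M * (y % M)) % M  ≡⟨ cong (λ z → (z * (y % M)) % M) (m%n%n≡m%n x M) ⟩
  (x % M * (y % M)) % M      ≡⟨ %-distribˡ-* x y M ⟨
  (x * y) % M                ∎
  where open ≡-Reasoning

%-absorbʳ-* : ∀ x y M .{{_ : NonZero M}} → (x * (y % M)) % M ≡ (x * y) % M
%-absorbʳ-* x y M = begin
  (x * (y % M)) % M  ≡⟨ cong (_% M) (*-comm x (y % M)) ⟩
  (y % M * x) % M    ≡⟨ %-absorbˡ-* y x M ⟩
  (y * x) % M        ≡⟨ cong (_% M) (*-comm y x) ⟩
  (x * y) % M        ∎
  where open ≡-Reasoning

[c+qn]/n≡q : ∀ c q n .{{_ : NonZero n}} → c < n → (c + q * n) / n ≡ q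
[c+qn]/n≡q c q n c<n = trans (+-distrib-/-∣ʳ c (divides q refl)) (cong₂ _+_ (m<n⇒m/n≡0 c<n) (m*n/n≡m q n))

[c+qn]%n≡c : ∀ c q n .{{_ : NonZero n}} → c < n → (c + q * n) % n ≡ c
[c+qn]%n≡c c q n c<n = trans ([m+kn]%n≡m%n c q n) (m<n⇒m%n≡m c<n)

m+n*o<p*o : ∀ {m n o p} → n < p → m < o → m + n * o < p * o
m+n*o<p*o {m} {n} {o} {p} n<p m<o = begin-strict
  m + n * o  <⟨ +-monoˡ-< (n * o) m<o ⟩
  o + n * o  ≤⟨ *-monoˡ-≤ o n<p ⟩
  p * o      ∎
  where open ≤-Reasoning

reverse< : ∀ {n f} → f < n → n ∸ suc f < n
reverse< {suc n} {f} (s≤s f≤n) = s≤s (m∸n≤m n f)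

reverse-reverse : ∀ {n f} → f < n → n ∸ suc (n ∸ suc f) ≡ f
reverse-reverse {suc n} (s≤s f≤n) = m∸[m∸n]≡n f≤n

+-cancelʳ-% : ∀ a c r M .{{_ : NonZero M}} → a < M → c < M → (a + r) % M ≡ (c + r) % M → a ≡ c
+-cancelʳ-% a c r M a<M c<M eq = begin
  a                                ≡⟨ untranslate a a<M ⟨
  ((a + r) % M + (M ∸ r % M)) % M  ≡⟨ cong (λ z → (z + (M ∸ r % M)) % M) eq ⟩
  ((c + r) % M + (M ∸ r % M)) % M  ≡⟨ untranslate c c<M ⟩
  c                                ∎
  where
  open ≡-Reasoning
  regroup : ∀ x ρ q e → x + (ρ + q) + e ≡ x + (ρ + e) + q
  regroup = solve-∀
  untranslate : ∀ x → x < M → ((x + r) % M + (M ∸ r % M)) % M ≡ x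
  untranslate x x<M = begin
    ((x + r) % M + (M ∸ r % M)) % M              ≡⟨ %-absorbˡ-+ (x + r) (M ∸ r % M) M ⟩
    (x + r + (M ∸ r % M)) % M                    ≡⟨ cong (λ z → (x + z + (M ∸ r % M)) % M) (m≡m%n+[m/n]*n r M) ⟩
    (x + (r % M + r / M * M) + (M ∸ r % M)) % M  ≡⟨ cong (_% M) (regroup x (r % M) (r / M * M) (M ∸ r % M)) ⟩
    (x + (r % M + (M ∸ r % M)) + r / M * M) % M  ≡⟨ cong (λ z → (x + z + r / M * M) % M) (m+[n∸m]≡n (m%n≤n r M)) ⟩
    (x + M + r / M * M) % M                      ≡⟨ [m+kn]%n≡m%n (x + M) (r / M) M ⟩
    (x + M) % M                                  ≡⟨ [m+n]%n≡m%n x M ⟩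
    x % M                                        ≡⟨ m<n⇒m%n≡m x<M ⟩
    x                                            ∎

successor-split : ∀ {x y r A Q M} .{{_ : NonZero M}} → A < M → y % M ≡ (x + r) % M →
  (x % M ≡ A × y / M ≡ Q) ⇔ (y ≡ (A + r) % M + Q * M)
successor-split {x} {y} {r} {A} {Q} {M} A<M carry = mk⇔ combine separate
  where
  open ≡-Reasoning
  combine : x % M ≡ A × y / M ≡ Q → y ≡ (A + r) % M + Q * M
  combine (x%M≡A , y/M≡Q) = begin
    y                  ≡⟨ m≡m%n+[m/n]*n y M ⟩
    y % M + y / M * M  ≡⟨ cong (_+ y / M * M) carry ⟩
    (x + r) % M + y / M * M         ≡⟨ cong (_+ y / M * M) (%-absorbˡ-+ x r M) ⟨
    (x % M + r) % M + y / M * M     ≡⟨ cong₂ (λ a q → (a + r) % M + q * M) x%M≡A y/M≡Q ⟩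
    (A + r) % M + Q * M             ∎
  separate : y ≡ (A + r) % M + Q * M → x % M ≡ A × y / M ≡ Q
  separate y≡ = +-cancelʳ-% (x % M) A r M (m%n<n x M) A<M low , high
    where
    low : (x % M + r) % M ≡ (A + r) % M
    low = begin
      (x % M + r) % M                ≡⟨ %-absorbˡ-+ x r M ⟩
      (x + r) % M                    ≡⟨ carry ⟨
      y % M                          ≡⟨ cong (_% M) y≡ ⟩
      ((A + r) % M + Q * M) % M      ≡⟨ [c+qn]%n≡c ((A + r) % M) Q M (m%n<n (A + r) M) ⟩
      (A + r) % M                    ∎
    high : y / M ≡ Q
    high = trans (cong (_/ M) y≡) ([c+qn]/n≡q ((A + r) % M) Q M (m%n<n (A + r) M))

ModInverse : (r M : ℕ) .{{_ : NonZero M}} → Set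
ModInverse r M = Σ ℕ λ r' → r * r' % M ≡ 1 % M

coprime-^ : ∀ {r b} k → Coprime r b → Coprime r (b ^ k)
coprime-^ zero    _   (_ , i∣1) = ∣1⇒≡1 i∣1
coprime-^ {r} {b} (suc k) r⊥b {i} (i∣r , i∣b*bᵏ) = coprime-^ k r⊥b (i∣r , coprime-divisor i⊥b i∣b*bᵏ)
  where
  i⊥b : Coprime i b
  i⊥b (d∣i , d∣b) = r⊥b (∣-trans d∣i i∣r , d∣b)

coprime⇒inverse : ∀ {r M} .{{_ : NonZero M}} → Coprime r M → ModInverse r M
coprime⇒inverse {r} {M} r⊥M with coprime-Bézout r⊥M
... | Bézout.+- x y 1+yM≡xr = x , (begin
  r * x % M        ≡⟨ cong (_% M) (*-comm r x) ⟩
  x * r % M        ≡⟨ cong (_% M) 1+yM≡xr ⟨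
  (1 + y * M) % M  ≡⟨ [m+kn]%n≡m%n 1 y M ⟩
  1 % M            ∎)
  where open ≡-Reasoning
... | Bézout.-+ x y 1+xr≡yM = (M ∸ 1) * x ,
  +-cancelʳ-% (r * ((M ∸ 1) * x) % M) (1 % M) (M ∸ 1) M (m%n<n _ M) (m%n<n 1 M) (begin
    (r * ((M ∸ 1) * x) % M + (M ∸ 1)) % M  ≡⟨ %-absorbˡ-+ (r * ((M ∸ 1) * x)) (M ∸ 1) M ⟩
    (r * ((M ∸ 1) * x) + (M ∸ 1)) % M      ≡⟨ cong (_% M) (factor (M ∸ 1) x r) ⟩
    ((M ∸ 1) * (1 + x * r)) % M            ≡⟨ cong (λ z → (M ∸ 1) * z % M) 1+xr≡yM ⟩
    ((M ∸ 1) * (y * M)) % M                ≡⟨ cong (_% M) (*-assoc (M ∸ 1) y M) ⟨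
    ((M ∸ 1) * y * M) % M                  ≡⟨ m*n%n≡0 ((M ∸ 1) * y) M ⟩
    0                                      ≡⟨ n%n≡0 M ⟨
    M % M                                  ≡⟨ cong (_% M) (m+[n∸m]≡n (>-nonZero⁻¹ M)) ⟨
    (1 + (M ∸ 1)) % M                      ≡⟨ %-absorbˡ-+ 1 (M ∸ 1) M ⟨
    (1 % M + (M ∸ 1)) % M                  ∎)
  where
  open ≡-Reasoning
  -- r·(P·x) + P = P·(1 + x·r): with P = M - 1 ≡ -1 this says r·(-x) ≡ 1
  factor : ∀ P x r → r * (P * x) + P ≡ P * (1 + x * r)
  factor = solve-∀

inverse-cancel : ∀ {r r' M} .{{_ : NonZero M}} → r * r' % M ≡ 1 % M → ∀ x → x * r % M * r' % M ≡ x % M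
inverse-cancel {r} {r'} {M} rr'≡1 x = begin
  x * r % M * r' % M    ≡⟨ %-absorbˡ-* (x * r) r' M ⟩
  x * r * r' % M        ≡⟨ cong (_% M) (*-assoc x r r') ⟩
  x * (r * r') % M      ≡⟨ %-absorbʳ-* x (r * r') M ⟨
  x * (r * r' % M) % M  ≡⟨ cong (λ z → x * z % M) rr'≡1 ⟩
  x * (1 % M) % M       ≡⟨ %-absorbʳ-* x 1 M ⟩
  x * 1 % M             ≡⟨ cong (_% M) (*-identityʳ x) ⟩
  x % M                 ∎
  where open ≡-Reasoning

successor-multiple : ∀ {r M} .{{_ : NonZero M}} → ModInverse r M → ∀ T → T < M →
  Σ ℕ λ j → j < M × suc j * r % M ≡ T
successor-multiple {r} {M} (r' , rr'≡1) T T<M = j , m%n<n _ M , (begin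
  suc j * r % M       ≡⟨ %-absorbˡ-* (suc j) r M ⟨
  suc j % M * r % M   ≡⟨ cong (λ z → z * r % M) 1+j≡Tr' ⟩
  T * r' % M * r % M  ≡⟨ inverse-cancel r'r≡1 T ⟩
  T % M               ≡⟨ m<n⇒m%n≡m T<M ⟩
  T                   ∎)
  where
  open ≡-Reasoning
  r'r≡1 : r' * r % M ≡ 1 % M
  r'r≡1 = trans (cong (_% M) (*-comm r' r)) rr'≡1
  -- j = T·r' - 1 modulo M
  j : ℕ
  j = (T * r' + (M ∸ 1)) % M
  1+j≡Tr' : suc j % M ≡ T * r' % M
  1+j≡Tr' = begin
    (1 + (T * r' + (M ∸ 1)) % M) % M  ≡⟨ %-absorbʳ-+ 1 (T * r' + (M ∸ 1)) M ⟩
    (1 + (T * r' + (M ∸ 1))) % M      ≡⟨ cong (_% M) (+-comm 1 (T * r' + (M ∸ 1))) ⟩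
    (T * r' + (M ∸ 1) + 1) % M        ≡⟨ cong (_% M) (+-assoc (T * r') (M ∸ 1) 1) ⟩
    (T * r' + (M ∸ 1 + 1)) % M        ≡⟨ cong (λ z → (T * r' + z) % M) (m∸n+n≡m (>-nonZero⁻¹ M)) ⟩
    (T * r' + M) % M                  ≡⟨ [m+n]%n≡m%n (T * r') M ⟩
    T * r' % M                        ∎

successor-multiple-unique : ∀ {r M} .{{_ : NonZero M}} → ModInverse r M → ∀ {j j'} → j < M → j' < M →
  suc j * r % M ≡ suc j' * r % M → j ≡ j'
successor-multiple-unique {r} {M} (r' , rr'≡1) {j} {j'} j<M j'<M eq = +-cancelʳ-% j j' 1 M j<M j'<M (begin
  (j + 1) % M              ≡⟨ cong (_% M) (+-comm j 1) ⟩
  suc j % M                ≡⟨ inverse-cancel rr'≡1 (suc j) ⟨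
  suc j * r % M * r' % M   ≡⟨ cong (λ z → z * r' % M) eq ⟩
  suc j' * r % M * r' % M  ≡⟨ inverse-cancel rr'≡1 (suc j') ⟩
  suc j' % M               ≡⟨ cong (_% M) (+-comm 1 j') ⟩
  (j' + 1) % M             ∎)
  where open ≡-Reasoning

module Digits (b : ℕ) {{_ : NonZero b}} where

  pow≢0 : ∀ e → NonZero (b ^ e)
  pow≢0 e = m^n≢0 b e

  _/b^_ : ℕ → ℕ → ℕ
  x /b^ q = _/_ x (b ^ q) {{pow≢0 q}}

  _%b^_ : ℕ → ℕ → ℕ
  x %b^ q = _%_ x (b ^ q) {{pow≢0 q}}

  infixl 7 _/b^_ _%b^_

  digit : ℕ → ℕ → ℕ
  digit x e = x / b ^ e % b
    where instance _ = pow≢0 e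

  -- The f-th digit of x written as an n-digit numeral, counted from the most
  -- significant one (this is how the word s lists digits).
  msd : ℕ → ℕ → ℕ → ℕ
  msd n x f = digit x (n ∸ suc f)

  digit-/ : ∀ x e q → digit x (e + q) ≡ digit (x /b^ q) e
  digit-/ x e q = cong (_% b) (begin
    x / b ^ (e + q)      ≡⟨ /-congʳ (trans (cong (b ^_) (+-comm e q)) (^-distribˡ-+-* b q e)) ⟩
    x / (b ^ q * b ^ e)  ≡⟨ m/n/o≡m/[n*o] x (b ^ q) (b ^ e) ⟨
    x / b ^ q / b ^ e    ∎)
    where
    open ≡-Reasoning
    instance _ = pow≢0 q ; _ = pow≢0 e ; _ = pow≢0 (e + q) ; _ = m*n≢0 (b ^ q) (b ^ e)

  digit-% : ∀ x e q → e < q → digit x e ≡ digit (x %b^ q) e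
  digit-% x e q e<q = sym (begin
    x % b ^ q / b ^ e % b                  ≡⟨ cong (λ z → z / b ^ e % b) (%-congʳ {o = x} bq≡) ⟩
    x % (b ^ (q ∸ e) * b ^ e) / b ^ e % b  ≡⟨ cong (_% b) (m%[n*o]/o≡m/o%n x (b ^ (q ∸ e)) (b ^ e)) ⟩
    x / b ^ e % b ^ (q ∸ e) % b            ≡⟨ m∣n⇒o%n%m≡o%m b (b ^ (q ∸ e)) (x / b ^ e) b∣bq-e ⟩
    x / b ^ e % b                          ∎)
    where
    open ≡-Reasoning
    instance _ = pow≢0 q ; _ = pow≢0 e ; _ = pow≢0 (q ∸ e) ; _ = m*n≢0 (b ^ (q ∸ e)) (b ^ e)
    bq≡ : b ^ q ≡ b ^ (q ∸ e) * b ^ e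
    bq≡ = trans (cong (b ^_) (sym (m∸n+n≡m (<⇒≤ e<q)))) (^-distribˡ-+-* b (q ∸ e) e)
    b∣bq-e : b ∣ b ^ (q ∸ e)
    b∣bq-e = subst (λ n → b ∣ b ^ n) (sym (+-∸-assoc 1 e<q)) (m∣m*n (b ^ (q ∸ suc e)))

  digit-ext : ∀ n {x y} → x < b ^ n → y < b ^ n → (∀ e → e < n → digit x e ≡ digit y e) → x ≡ y
  digit-ext zero {x} {y} x<1 y<1 _ = trans (n<1⇒n≡0 x<1) (sym (n<1⇒n≡0 y<1))
  digit-ext (suc n) {x} {y} x<bⁿ⁺¹ y<bⁿ⁺¹ same = begin
    x                  ≡⟨ m≡m%n+[m/n]*n x b ⟩
    x % b + x / b * b  ≡⟨ cong₂ (λ l h → l + h * b) lowest higher ⟩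
    y % b + y / b * b  ≡⟨ m≡m%n+[m/n]*n y b ⟨
    y                  ∎
    where
    open ≡-Reasoning
    lowest : x % b ≡ y % b
    lowest = trans (cong (_% b) (sym (n/1≡n x))) (trans (same 0 z<s) (cong (_% b) (n/1≡n y)))
    shift : ∀ z e → digit (z / b) e ≡ digit z (suc e)
    shift z e = cong (_% b) (m/n/o≡m/[n*o] z b (b ^ e) {{_}} {{pow≢0 e}} {{pow≢0 (suc e)}})
    quotient< : ∀ {z} → z < b ^ suc n → z / b < b ^ n
    quotient< {z} z< = m<n*o⇒m/o<n (subst (z <_) (*-comm b (b ^ n)) z<)
    higher : x / b ≡ y / b
    higher = digit-ext n (quotient< x<bⁿ⁺¹) (quotient< y<bⁿ⁺¹)
      (λ e e<n → trans (shift x e) (trans (same (suc e) (s<s e<n)) (sym (shift y e))))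

  msd-ext : ∀ n {x y} → x < b ^ n → y < b ^ n → (∀ f → f < n → msd n x f ≡ msd n y f) → x ≡ y
  msd-ext n {x} {y} x<bⁿ y<bⁿ same = digit-ext n x<bⁿ y<bⁿ λ e e<n →
    subst (λ z → digit x z ≡ digit y z) (reverse-reverse e<n) (same (n ∸ suc e) (reverse< e<n))

  msd-prefix : ∀ p q x f → f < p → msd (p + q) x f ≡ msd p (x /b^ q) f
  msd-prefix p q x f f<p = trans (cong (digit x) (+-∸-comm q f<p)) (digit-/ x (p ∸ suc f) q)

  msd-suffix : ∀ p q x c → c < q → msd (p + q) x (p + c) ≡ msd q (x %b^ q) c
  msd-suffix p q x c c<q = trans (cong (digit x) index) (digit-% x (q ∸ suc c) q (reverse< c<q))
    where
    index : p + q ∸ suc (p + c) ≡ q ∸ suc c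
    index = trans (cong (p + q ∸_) (sym (+-suc p c))) ([m+n]∸[m+o]≡n∸o p q (suc c))

  value : (n : ℕ) → (Fin n → Fin b) → ℕ
  value zero    _ = 0
  value (suc n) u = value n (λ i → u (suc i)) + toℕ (u zero) * b ^ n

  value< : ∀ n u → value n u < b ^ n
  value< zero    _ = z<s
  value< (suc n) u = m+n*o<p*o (toℕ<n (u zero)) (value< n (λ i → u (suc i)))

  msd-value : ∀ n u (t : Fin n) → msd n (value n u) (toℕ t) ≡ toℕ (u t)
  msd-value (suc n) u zero = begin
    (rest + a * b ^ n) / b ^ n % b  ≡⟨ cong (_% b) ([c+qn]/n≡q rest a (b ^ n) (value< n _)) ⟩
    a % b                           ≡⟨ m<n⇒m%n≡m (toℕ<n (u zero)) ⟩
    a                               ∎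
    where
    open ≡-Reasoning
    instance _ = pow≢0 n
    a rest : ℕ
    a = toℕ (u zero)
    rest = value n (λ i → u (suc i))
  msd-value (suc n) u (suc t) = begin
    msd (1 + n) (rest + a * b ^ n) (1 + toℕ t)  ≡⟨ msd-suffix 1 n (rest + a * b ^ n) (toℕ t) (toℕ<n t) ⟩
    msd n ((rest + a * b ^ n) % b ^ n) (toℕ t)  ≡⟨ cong (λ z → msd n z (toℕ t)) ([c+qn]%n≡c rest a (b ^ n) (value< n _)) ⟩
    msd n rest (toℕ t)                          ≡⟨ msd-value n (λ i → u (suc i)) t ⟩
    toℕ (u (suc t))                             ∎
    where
    open ≡-Reasoning
    instance _ = pow≢0 n
    a rest : ℕ
    a = toℕ (u zero)
    rest = value n (λ i → u (suc i))

module Necklace (b k r : ℕ) {{_ : NonZero b}} {{_ : NonZero k}} where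

  open Digits b

  B N : ℕ
  B = b ^ k
  N = k * B

  instance
    B≢0 : NonZero B
    B≢0 = pow≢0 k
    N≢0 : NonZero N
    N≢0 = m*n≢0 k B

  block : ℕ → ℕ
  block j = j * r % B

  -- The letter at position p of the periodic extension of s; for p < N it is
  -- by definition the letter of multWord b k r at p.
  letter : ℕ → ℕ
  letter p = msd k (block (p / k)) (p % k)

  letter-periodic : ∀ p → letter (p % N) ≡ letter p
  letter-periodic p = begin
    msd k ((p % N / k) * r % B) (p % N % k)  ≡⟨ cong₂ (λ j t → msd k (j * r % B) t) block-index offset ⟩
    msd k ((p / k % B) * r % B) (p % k)      ≡⟨ cong (λ x → msd k x (p % k)) (%-absorbˡ-* (p / k) r B) ⟩
    msd k ((p / k) * r % B) (p % k)          ∎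
    where
    open ≡-Reasoning
    instance _ = m*n≢0 B k
    block-index : p % N / k ≡ p / k % B
    block-index = trans (cong (_/ k) (%-congʳ {o = p} (*-comm k B))) (m%[n*o]/o≡m/o%n p B k)
    offset : p % N % k ≡ p % k
    offset = m∣n⇒o%n%m≡o%m k N p (m∣m*n B)

  letter-word : ∀ i (i%N<N : i % N < N) → toℕ (multWord b k r (fromℕ< i%N<N)) ≡ letter i
  letter-word i i%N<N = trans (toℕ-fromℕ< _) (trans (cong letter (toℕ-fromℕ< i%N<N)) (letter-periodic i))

  letter-block : ∀ j t → t < k → letter (t + j * k) ≡ msd k (block j) t
  letter-block j t t<k = cong₂ (λ i f → msd k (block i) f) ([c+qn]/n≡q t j k t<k) ([c+qn]%n≡c t j k t<k)

  Matches : ℕ → ℕ → Set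
  Matches i U = ∀ t → t < k → letter (i + t) ≡ msd k U t

  occurs⇔matches : ∀ u i → OccursAt u (multWord b k r) i ⇔ Matches i (value k u)
  occurs⇔matches u i = mk⇔ matches occurs
    where
    matches : OccursAt u (multWord b k r) i → Matches i (value k u)
    matches occ t t<k = subst (λ f → letter (i + f) ≡ msd k (value k u) f) (toℕ-fromℕ< t<k) (begin
      letter (i + toℕ a)                 ≡⟨ letter-word (i + toℕ a) i+a<N ⟨
      toℕ (multWord b k r (fromℕ< i+a<N)) ≡⟨ cong toℕ (occ a i+a<N) ⟩
      toℕ (u a)                          ≡⟨ msd-value k u a ⟨
      msd k (value k u) (toℕ a)          ∎)
      where
      open ≡-Reasoning
      a : Fin k
      a = fromℕ< t<k
      i+a<N : (i + toℕ a) % N < N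
      i+a<N = m%n<n (i + toℕ a) N
    occurs : Matches i (value k u) → OccursAt u (multWord b k r) i
    occurs spells a i+a<N = toℕ-injective (begin
      toℕ (multWord b k r (fromℕ< i+a<N)) ≡⟨ letter-word (i + toℕ a) i+a<N ⟩
      letter (i + toℕ a)                 ≡⟨ spells (toℕ a) (toℕ<n a) ⟩
      msd k (value k u) (toℕ a)          ≡⟨ msd-value k u a ⟩
      toℕ (u a)                          ∎)
      where open ≡-Reasoning

  -- Windows starting at offset t inside a block, where k = t + m: such a window
  -- reads the last m digits of one block and then the first t digits of the next.
  module Window (t m : ℕ) (split : k ≡ t + m) where

    instance _ = pow≢0 t ; _ = pow≢0 m

    B≡bᵗbᵐ : B ≡ b ^ t * b ^ m
    B≡bᵗbᵐ = trans (cong (b ^_) split) (^-distribˡ-+-* b t m)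

    B≡bᵐbᵗ : B ≡ b ^ m * b ^ t
    B≡bᵐbᵗ = trans B≡bᵗbᵐ (*-comm (b ^ t) (b ^ m))

    div-bᵗ< : ∀ {x} → x < B → x /b^ t < b ^ m
    div-bᵗ< {x} x<B = m<n*o⇒m/o<n (subst (x <_) B≡bᵐbᵗ x<B)

    div-bᵐ< : ∀ {x} → x < B → x /b^ m < b ^ t
    div-bᵐ< {x} x<B = m<n*o⇒m/o<n (subst (x <_) B≡bᵗbᵐ x<B)

    window-low : ∀ j f → f < m → letter (t + j * k + f) ≡ msd m (block j %b^ m) f
    window-low j f f<m = begin
      letter (t + j * k + f)        ≡⟨ cong letter (swap t (j * k) f) ⟩
      letter (t + f + j * k)        ≡⟨ letter-block j (t + f) t+f<k ⟩
      msd k (block j) (t + f)       ≡⟨ cong (λ n → msd n (block j) (t + f)) split ⟩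
      msd (t + m) (block j) (t + f) ≡⟨ msd-suffix t m (block j) f f<m ⟩
      msd m (block j %b^ m) f       ∎
      where
      open ≡-Reasoning
      swap : ∀ x y z → x + y + z ≡ x + z + y
      swap = solve-∀
      t+f<k : t + f < k
      t+f<k = subst (t + f <_) (sym split) (+-monoʳ-< t f<m)

    window-high : ∀ j c → c < t → letter (t + j * k + (m + c)) ≡ msd t (block (suc j) /b^ m) c
    window-high j c c<t = begin
      letter (t + j * k + (m + c))    ≡⟨ cong letter next-block ⟩
      letter (c + suc j * k)          ≡⟨ letter-block (suc j) c c<k ⟩
      msd k (block (suc j)) c         ≡⟨ cong (λ n → msd n (block (suc j)) c) split ⟩
      msd (t + m) (block (suc j)) c   ≡⟨ msd-prefix t m (block (suc j)) c c<t ⟩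
      msd t (block (suc j) /b^ m) c   ∎
      where
      open ≡-Reasoning
      c<k : c < k
      c<k = subst (c <_) (sym split) (≤-trans c<t (m≤m+n t m))
      regroup : ∀ t m j c → t + j * (t + m) + (m + c) ≡ c + suc j * (t + m)
      regroup = solve-∀
      next-block : t + j * k + (m + c) ≡ c + suc j * k
      next-block = subst (λ n → t + j * n + (m + c) ≡ c + suc j * n) (sym split) (regroup t m j c)

    value-low : ∀ U f → f < m → msd k U f ≡ msd m (U /b^ t) f
    value-low U f f<m = trans (cong (λ n → msd n U f) (trans split (+-comm t m))) (msd-prefix m t U f f<m)

    value-high : ∀ U c → c < t → msd k U (m + c) ≡ msd t (U %b^ t) c
    value-high U c c<t = trans (cong (λ n → msd n U (m + c)) (trans split (+-comm t m))) (msd-suffix m t U c c<t)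

    matches⇔ends : ∀ j U → U < B →
      Matches (t + j * k) U ⇔ (block j %b^ m ≡ U /b^ t × block (suc j) /b^ m ≡ U %b^ t)
    matches⇔ends j U U<B = mk⇔ ends window
      where
      ends : Matches (t + j * k) U → block j %b^ m ≡ U /b^ t × block (suc j) /b^ m ≡ U %b^ t
      ends spells =
        msd-ext m (m%n<n (block j) (b ^ m)) (div-bᵗ< U<B) (λ f f<m →
          trans (sym (window-low j f f<m)) (trans (spells f (f<k f<m)) (value-low U f f<m))) ,
        msd-ext t (div-bᵐ< (m%n<n (suc j * r) B)) (m%n<n U (b ^ t)) (λ c c<t →
          trans (sym (window-high j c c<t)) (trans (spells (m + c) (m+c<k c<t)) (value-high U c c<t)))
        where
        f<k : ∀ {f} → f < m → f < k
        f<k {f} f<m = subst (f <_) (sym split) (≤-trans f<m (m≤n+m m t))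
        m+c<k : ∀ {c} → c < t → m + c < k
        m+c<k {c} c<t = subst (m + c <_) (trans (+-comm m t) (sym split)) (+-monoʳ-< m c<t)
      window : block j %b^ m ≡ U /b^ t × block (suc j) /b^ m ≡ U %b^ t → Matches (t + j * k) U
      window (low , high) f f<k with f <? m
      ... | yes f<m = begin
        letter (t + j * k + f)   ≡⟨ window-low j f f<m ⟩
        msd m (block j %b^ m) f  ≡⟨ cong (λ x → msd m x f) low ⟩
        msd m (U /b^ t) f        ≡⟨ value-low U f f<m ⟨
        msd k U f                ∎
        where open ≡-Reasoning
      ... | no f≮m = subst (λ f → letter (t + j * k + f) ≡ msd k U f) m+c≡f (begin
        letter (t + j * k + (m + c))   ≡⟨ window-high j c c<t ⟩
        msd t (block (suc j) /b^ m) c  ≡⟨ cong (λ x → msd t x c) high ⟩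
        msd t (U %b^ t) c              ≡⟨ value-high U c c<t ⟨
        msd k U (m + c)                ∎)
        where
        open ≡-Reasoning
        c : ℕ
        c = f ∸ m
        m+c≡f : m + c ≡ f
        m+c≡f = m+[n∸m]≡n (≮⇒≥ f≮m)
        c<t : c < t
        c<t = +-cancelˡ-< m c t (subst₂ _<_ (sym m+c≡f) (trans split (+-comm t m)) f<k)

    -- Consecutive blocks differ by r modulo b^m, because b^m divides B.
    block-carry : ∀ j → block (suc j) %b^ m ≡ (block j + r) %b^ m
    block-carry j = begin
      suc j * r % B % b ^ m          ≡⟨ m∣n⇒o%n%m≡o%m (b ^ m) B (suc j * r) bᵐ∣B ⟩
      (r + j * r) % b ^ m            ≡⟨ cong (_% b ^ m) (+-comm r (j * r)) ⟩
      (j * r + r) % b ^ m            ≡⟨ %-absorbˡ-+ (j * r) r (b ^ m) ⟨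
      (j * r % b ^ m + r) % b ^ m    ≡⟨ cong (λ z → (z + r) % b ^ m) (m∣n⇒o%n%m≡o%m (b ^ m) B (j * r) bᵐ∣B) ⟨
      (j * r % B % b ^ m + r) % b ^ m ≡⟨ %-absorbˡ-+ (block j) r (b ^ m) ⟩
      (block j + r) % b ^ m          ∎
      where
      open ≡-Reasoning
      bᵐ∣B : b ^ m ∣ B
      bᵐ∣B = divides (b ^ t) B≡bᵗbᵐ

    -- The numeral that block (j + 1) must equal for the window at t + j·k to spell U.
    target : ℕ → ℕ
    target U = (U /b^ t + r) %b^ m + U %b^ t * b ^ m

    target< : ∀ U → target U < B
    target< U = subst (target U <_) (sym B≡bᵗbᵐ) (m+n*o<p*o (m%n<n U (b ^ t)) (m%n<n _ (b ^ m)))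

    matches⇔target : ∀ j U → U < B → Matches (t + j * k) U ⇔ block (suc j) ≡ target U
    matches⇔target j U U<B =
      successor-split (div-bᵗ< U<B) (block-carry j) ⇔-∘ matches⇔ends j U U<B

  module Occurrences (inverse : ModInverse r B) (u : Word b k) where

    U : ℕ
    U = value k u

    offset-split : (a : Fin k) → k ≡ toℕ a + (k ∸ toℕ a)
    offset-split a = sym (m+[n∸m]≡n (<⇒≤ (toℕ<n a)))

    module W (a : Fin k) = Window (toℕ a) (k ∸ toℕ a) (offset-split a)

    solution : (a : Fin k) → Σ ℕ λ j → j < B × suc j * r % B ≡ W.target a U
    solution a = successor-multiple inverse (W.target a U) (W.target< a U)

    position : Fin k → ℕ
    position a = toℕ a + proj₁ (solution a) * k

    position< : ∀ a → position a < N
    position< a = subst (position a <_) (*-comm B k) (m+n*o<p*o (proj₁ (proj₂ (solution a))) (toℕ<n a))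

    position-offset : ∀ a → position a % k ≡ toℕ a
    position-offset a = [c+qn]%n≡c (toℕ a) (proj₁ (solution a)) k (toℕ<n a)

    position-occurs : ∀ a → OccursAt u (multWord b k r) (position a)
    position-occurs a = from (occurs⇔matches u (position a))
      (from (W.matches⇔target a (proj₁ (solution a)) U (value< k u)) (proj₂ (proj₂ (solution a))))

    -- Every occurrence is one of these: its offset a determines its block uniquely.
    position-complete : ∀ i → i < N → OccursAt u (multWord b k r) i → Σ (Fin k) λ a → position a ≡ i
    position-complete i i<N occ = a , (begin
      toℕ a + proj₁ (solution a) * k  ≡⟨ cong (λ j → toℕ a + j * k) same-block ⟨
      toℕ a + i / k * k               ≡⟨ i≡ ⟨
      i                               ∎)
      where
      open ≡-Reasoning
      a : Fin k
      a = fromℕ< (m%n<n i k)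
      i≡ : i ≡ toℕ a + i / k * k
      i≡ = trans (m≡m%n+[m/n]*n i k) (cong (_+ i / k * k) (sym (toℕ-fromℕ< (m%n<n i k))))
      i/k<B : i / k < B
      i/k<B = m<n*o⇒m/o<n (subst (i <_) (*-comm k B) i<N)
      next-is-target : block (suc (i / k)) ≡ W.target a U
      next-is-target = to (W.matches⇔target a (i / k) U (value< k u))
        (subst (λ p → Matches p U) i≡ (to (occurs⇔matches u i) occ))
      same-block : i / k ≡ proj₁ (solution a)
      same-block = successor-multiple-unique inverse i/k<B (proj₁ (proj₂ (solution a)))
        (trans next-is-target (sym (proj₂ (proj₂ (solution a)))))

    position-injective : ∀ a c → position a % k ≡ position c % k → a ≡ c
    position-injective a c same = toℕ-injective (trans (sym (position-offset a)) (trans same (position-offset c)))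

    perfect : Σ (Fin k → ℕ) λ pos →
      ((a : Fin k) → (pos a < N) × OccursAt u (multWord b k r) (pos a)) ×
      ((a c : Fin k) → pos a % k ≡ pos c % k → a ≡ c) ×
      ((i : ℕ) → i < N → OccursAt u (multWord b k r) i → Σ (Fin k) λ a → pos a ≡ i)
    perfect = position , (λ a → position< a , position-occurs a) , position-injective , position-complete

theorem2p3 : (b k r : ℕ) → 2 ≤ b → 1 ≤ k → 1 ≤ r → Coprime r b →
    {{nb : NonZero b}} → {{nk : NonZero k}} →
    IsKNPerfect {{lenNonZero b k}} k k (multWord b k r)
theorem2p3 b k r _ _ _ r⊥b = refl , Occurrences.perfect r-invertible
  where
  open Necklace b k r
  r-invertible : ModInverse r B
  r-invertible = coprime⇒inverse (coprime-^ k r⊥b)
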